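{- Let $X$ be a set, let $\check{a}$ be a set of sets of subsets of $X$, and let $\underline{a}=\bigcup\{\bigcap\hat{a}:\hat{a}\in\check{a}\}$ and $\overline{a}=\bigcap\{\bigcup\hat{a}:\hat{a}\in\check{a}\}$. Then $[\![\underline{a},\overline{a}]\!]\sim\check{a}$.
   Context: Intersections of empty families of subsets of $X$ are taken to be $X$. For subsets $y,z$ of $X$, $[y,z]:=\{d\subseteq X: y\subseteq d\subseteq z\}$. For subsets $\underline{x},\overline{x}$ of $X$, the biinterval is $[\![\underline{x},\overline{x}]\!]:=\{[y,y\cup\overline{x}] : y\in[\underline{x}\cap\overline{x},\underline{x}]\}$. For sets $\check{a}_1,\check{a}_2$ of sets of subsets of $X$, $\check{a}_1\sim\check{a}_2$ iff $\bigcup\{\bigcap\hat{a}:\hat{a}\in\check{a}_1\}=\bigcup\{\bigcap\hat{a}:\hat{a}\in\check{a}_2\}$ and $\bigcap\{\bigcup\hat{a}:\hat{a}\in\check{a}_1\}=\bigcap\{\bigcup\hat{a}:\hat{a}\in\check{a}_2\}$. -}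

module Defs where

open import Level using (Level; _⊔_; suc)
open import Data.Product using (Σ; _×_; ∃)
open import Relation.Unary using (Pred; _⊆_; _∪_; _∩_; _≐_)

private
  variable
    ℓx a b c : Level

-- Subsets of X are predicates X → Set a.
-- ⋂ â  (intersection of a set of subsets; empty family gives X)
⋂ : {X : Set ℓx} → Pred (Pred X a) b → Pred X (ℓx ⊔ suc a ⊔ b)
⋂ {X = X} â x = (d : Pred X _) → â d → d x

⋃ : {X : Set ℓx} → Pred (Pred X a) b → Pred X (ℓx ⊔ suc a ⊔ b)
⋃ {X = X} â x = Σ (Pred X _) λ d → â d × d x

lower : ∀ {ℓx a b c} {X : Set ℓx} → Pred (Pred (Pred X a) b) c → Pred X _
lower {a = a} {b = b} {X = X} ǎ x = Σ (Pred (Pred X a) b) λ â → ǎ â × ⋂ â x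

upper : ∀ {ℓx a b c} {X : Set ℓx} → Pred (Pred (Pred X a) b) c → Pred X _
upper {a = a} {b = b} {X = X} ǎ x = (â : Pred (Pred X a) b) → ǎ â → ⋃ â x

Interval : {X : Set ℓx} (a : Level) → Pred X b → Pred X c → Pred (Pred X a) (ℓx ⊔ a ⊔ b ⊔ c)
Interval a y z d = (y ⊆ d) × (d ⊆ z)

-- A member â of the biinterval is a set of subsets extensionally equal to some [y , y ∪ hi].
Biinterval : ∀ {ℓx a} {X : Set ℓx} → Pred X a → Pred X a →
             Pred (Pred (Pred X a) (ℓx ⊔ a)) (ℓx ⊔ suc a)
Biinterval {a = a} {X = X} lo hi â =
  Σ (Pred X a) λ y → Interval a (lo ∩ hi) lo y × (â ≐ Interval a y (y ∪ hi))

_∼_ : ∀ {ℓx a₁ b₁ c₁ a₂ b₂ c₂} {X : Set ℓx} →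
      Pred (Pred (Pred X a₁) b₁) c₁ → Pred (Pred (Pred X a₂) b₂) c₂ → Set _
ǎ₁ ∼ ǎ₂ = (lower ǎ₁ ≐ lower ǎ₂) × (upper ǎ₁ ≐ upper ǎ₂)

-- An interval [y , z] with y ⊆ z has intersection y and union z. Hence the
-- lower bound of ⟦ lo , hi ⟧ is the union of its admissible y, i.e. lo, and its
-- upper bound is the intersection of the sets y ∪ hi, attained at y = lo ∩ hi,
-- i.e. hi. This holds for arbitrary lo and hi; the theorem takes lo = lower ǎ
-- and hi = upper ǎ.
module Submission where

open import Level using (Level)
open import Data.Product using (_,_; proj₁; proj₂)
open import Data.Sum using (inj₁; inj₂; [_,_])
open import Function using (id)
open import Relation.Unary using (Pred; _⊆_; _∪_; _≐_)
open import Defs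

private
  variable
    ℓx a b : Level
    X : Set ℓx

⋂-antitone : {â ê : Pred (Pred X a) b} → â ⊆ ê → ⋂ ê ⊆ ⋂ â
⋂-antitone â⊆ê x∈⋂ê d d∈â = x∈⋂ê d (â⊆ê d∈â)

⋃-monotone : {â ê : Pred (Pred X a) b} → â ⊆ ê → ⋃ â ⊆ ⋃ ê
⋃-monotone â⊆ê (d , d∈â , x∈d) = d , â⊆ê d∈â , x∈d

⋂-Interval : {y z : Pred X a} → y ⊆ z → ⋂ (Interval a y z) ≐ y
⋂-Interval y⊆z = (λ x∈⋂ → x∈⋂ _ (id , y⊆z))
               , (λ x∈y d (y⊆d , _) → y⊆d x∈y)

⋃-Interval : {y z : Pred X a} → y ⊆ z → ⋃ (Interval a y z) ≐ z
⋃-Interval y⊆z = (λ (d , (_ , d⊆z) , x∈d) → d⊆z x∈d)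
               , (λ x∈z → _ , (y⊆z , id) , x∈z)

lower-Biinterval : (lo hi : Pred X a) → lower (Biinterval lo hi) ≐ lo
lower-Biinterval {a = a} lo hi = lower⊆lo , lo⊆lower
  where
  lower⊆lo : lower (Biinterval lo hi) ⊆ lo
  lower⊆lo (â , (y , (_ , y⊆lo) , â≐I) , x∈⋂â) =
    y⊆lo (proj₁ (⋂-Interval inj₁) (⋂-antitone (proj₂ â≐I) x∈⋂â))

  lo⊆lower : lo ⊆ lower (Biinterval lo hi)
  lo⊆lower x∈lo = Interval a lo (lo ∪ hi)
                , (lo , (proj₁ , id) , (id , id))
                , proj₂ (⋂-Interval inj₁) x∈lo

upper-Biinterval : (lo hi : Pred X a) → upper (Biinterval lo hi) ≐ hi
upper-Biinterval {a = a} lo hi = upper⊆hi , hi⊆upper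
  where
  upper⊆hi : upper (Biinterval lo hi) ⊆ hi
  upper⊆hi x∈upper =
    [ proj₂ , id ] (proj₁ (⋃-Interval inj₁)
                     (x∈upper _ (_ , (id , proj₁) , (id , id))))

  hi⊆upper : hi ⊆ upper (Biinterval lo hi)
  hi⊆upper x∈hi â (_ , _ , â≐I) =
    ⋃-monotone (proj₂ â≐I) (proj₂ (⋃-Interval inj₁) (inj₂ x∈hi))

lemma3 : ∀ {ℓx a b c} {X : Set ℓx} (ǎ : Pred (Pred (Pred X a) b) c) →
    Biinterval (lower ǎ) (upper ǎ) ∼ ǎ
lemma3 ǎ = lower-Biinterval (lower ǎ) (upper ǎ)
         , upper-Biinterval (lower ǎ) (upper ǎ)
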